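{- Let $\pi\in PM_{2n}$. Then the intertwining number satisfies $\mathrm{i}(\pi)=3\,\mathrm{cr}(\pi)+2\,\mathrm{ne}(\pi)+\mathrm{al}(\pi)$.
   Context: A perfect matching on $[2n]$ is a set partition of $[2n]$ into blocks of size $2$; $PM_{2n}$ is the set of them. A block $\{i<j\}$ is an arc $(i,j)$. For two arcs $e=(i,j)$, $f=(k,l)$ of $\pi$ with $i<k$, the pair is a crossing if $i<k<j<l$, a nesting if $i<k<l<j$, and an alignment if $i<j<k<l$; $\mathrm{cr}(\pi)$, $\mathrm{ne}(\pi)$, $\mathrm{al}(\pi)$ denote the numbers of crossings, nestings and alignments. The extended arc diagram of $\pi$ consists of the arcs of $\pi$ together with a generalized arc $(-\infty,i)$ for each opener $i$ (the minimum of a block) and a generalized arc $(j,\infty)$ for each closer $j$ (the maximum of a block). Two generalized arcs $(a,b)$ and $(c,d)$ cross if $a<c<b<d$ (with $-\infty$ below and $\infty$ above every integer, and $-\infty<-\infty$, $\infty<\infty$ false). The intertwining number $\mathrm{i}(\pi)$ is the number of crossing pairs of generalized arcs in the extended arc diagram. -}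

module Defs where

open import Data.Nat using (ℕ; zero; suc; _+_; _*_; _<ᵇ_)
open import Data.Fin using (Fin; toℕ)
open import Data.Bool using (Bool; true; false; _∧_; if_then_else_)
open import Data.List using (List; []; _∷_; _++_; map; filter; concatMap; length)
open import Data.Nat.ListAction using (sum)
open import Data.List using (allFin)
open import Data.Product using (_×_; _,_)
open import Relation.Binary.PropositionalEquality using (_≡_; _≢_)

-- A perfect matching on [2n] (points are Fin (2 * n)) is a set partition into
-- blocks of size 2, encoded as a fixed-point-free involution: block {i , π i}.
record PM (n : ℕ) : Set where
  field
    partner    : Fin (2 * n) → Fin (2 * n)
    involutive : ∀ i → partner (partner i) ≡ i
    noFixed    : ∀ i → partner i ≢ i
open PM public

_<ᶠ_ : ∀ {m} → Fin m → Fin m → Bool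
i <ᶠ j = toℕ i <ᵇ toℕ j

countPairs : ∀ {A : Set} → (A → A → Bool) → List A → ℕ
countPairs R xs = sum (concatMap (λ x → map (λ y → if R x y then 1 else 0) xs) xs)

arcs : ∀ {n} → PM n → List (Fin (2 * n) × Fin (2 * n))
arcs {n} π = concatMap (λ i → if i <ᶠ partner π i then (i , partner π i) ∷ [] else []) (allFin (2 * n))

isCrossing isNesting isAlignment : ∀ {m} → Fin m × Fin m → Fin m × Fin m → Bool
isCrossing  (i , j) (k , l) = (i <ᶠ k) ∧ (k <ᶠ j) ∧ (j <ᶠ l)
isNesting   (i , j) (k , l) = (i <ᶠ k) ∧ (k <ᶠ l) ∧ (l <ᶠ j)
isAlignment (i , j) (k , l) = (i <ᶠ j) ∧ (j <ᶠ k) ∧ (k <ᶠ l)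

cr ne al : ∀ {n} → PM n → ℕ
cr π = countPairs isCrossing  (arcs π)
ne π = countPairs isNesting   (arcs π)
al π = countPairs isAlignment (arcs π)

data Ext (m : ℕ) : Set where
  -∞ : Ext m
  pt : Fin m → Ext m
  +∞ : Ext m

_<ᵉ_ : ∀ {m} → Ext m → Ext m → Bool
-∞   <ᵉ -∞   = false
-∞   <ᵉ pt _ = true
-∞   <ᵉ +∞   = true
pt _ <ᵉ -∞   = false
pt i <ᵉ pt j = i <ᶠ j
pt _ <ᵉ +∞   = true
+∞   <ᵉ _    = false

openers closers : ∀ {n} → PM n → List (Fin (2 * n))
openers {n} π = filter (λ i → Data.Bool._≟_ (i <ᶠ partner π i) true) (allFin (2 * n))
  where import Data.Bool
closers {n} π = filter (λ i → Data.Bool._≟_ (partner π i <ᶠ i) true) (allFin (2 * n))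
  where import Data.Bool

extendedArcs : ∀ {n} → PM n → List (Ext (2 * n) × Ext (2 * n))
extendedArcs π =
  map (λ { (i , j) → (pt i , pt j) }) (arcs π)
  ++ map (λ i → (-∞ , pt i)) (openers π)
  ++ map (λ j → (pt j , +∞)) (closers π)

crossesᵉ : ∀ {m} → Ext m × Ext m → Ext m × Ext m → Bool
crossesᵉ (a , b) (c , d) = (a <ᵉ c) ∧ (c <ᵉ b) ∧ (b <ᵉ d)

intertwining : ∀ {n} → PM n → ℕ
intertwining π = countPairs crossesᵉ (extendedArcs π)

-- Each arc (a , b) of π contributes three generalized arcs, (a , b), (-∞ , a) and (b , +∞),
-- so i(π) is a sum over ordered pairs (e , f) of arcs of the number of crossings from a
-- generalized arc of e to one of f.  Distinct arcs of a matching have four distinct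
-- endpoints, and for such a pair the two orders together contribute 3, 2 or 1 according as
-- the arcs cross, nest or are aligned, which is also what the two orders contribute to
-- 3 cr + 2 ne + al; an arc paired with itself contributes nothing to either.  Summing the
-- symmetrized counts over all ordered pairs thus gives twice each side of the identity.
module Submission where

open import Defs
open import Algebra.Properties.CommutativeSemigroup using (x∙yz≈y∙xz)
open import Data.Bool using (Bool; true; false; T; if_then_else_)
open import Data.Bool.Properties using (T-≡)
import Data.Bool
open import Data.Fin using (Fin; _<_; _≟_) renaming (zero to fzero; suc to fsuc)
open import Data.Fin.Permutation using (Permutation; permutation)
open import Data.Fin.Properties using (<-cmp; <-trans; <-asym; <-irrefl)
open import Data.List using (List; []; _∷_; _++_; map; filter; concatMap; allFin; tabulate)
open import Data.List.Properties using (map-++; map-cong; map-∘; map-tabulate)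
open import Data.Nat using (ℕ; zero; suc; _+_; _*_)
open import Data.Nat.ListAction using (sum)
open import Data.Nat.ListAction.Properties using (sum-++)
open import Data.Nat.Properties
  using (+-*-semiring; *-commutativeSemigroup; <⇒<ᵇ; <ᵇ⇒<; +-comm; +-identityʳ;
         *-zeroʳ; *-distribˡ-+; *-cancelˡ-≡)
open import Algebra.Properties.Semiring.Sum +-*-semiring
  using (sum-syntax; ∑-comm; ∑-distrib-+; *-distribˡ-sum; ∑-permute; sum-cong-≗;
         sum-replicate-zero)
open import Data.Product using (_×_; _,_)
open import Data.Sum using (_⊎_; inj₁; inj₂)
open import Function using (Equivalence; _∘_; flip)
open import Relation.Binary.Definitions using (tri<; tri≈; tri>)
open import Relation.Binary.PropositionalEquality
open import Relation.Nullary using (yes; no; contradiction)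

private variable
  A : Set
  m : ℕ

⟦_⟧ : Bool → ℕ
⟦ b ⟧ = if b then 1 else 0

⟦⟧*-cong : ∀ b {x y} → (T b → x ≡ y) → ⟦ b ⟧ * x ≡ ⟦ b ⟧ * y
⟦⟧*-cong true  x≡y = cong (_+ 0) (x≡y _)
⟦⟧*-cong false _   = refl

<⇒<ᶠ : {i j : Fin m} → i < j → (i <ᶠ j) ≡ true
<⇒<ᶠ i<j = Equivalence.to T-≡ (<⇒<ᵇ i<j)

<⇒≯ᶠ : {i j : Fin m} → i < j → (j <ᶠ i) ≡ false
<⇒≯ᶠ {i = i} {j} i<j with j <ᶠ i in eq
... | false = refl
... | true  = contradiction (<ᵇ⇒< _ _ (Equivalence.from T-≡ eq)) (<-asym i<j)

<ᶠ-irrefl : (i : Fin m) → (i <ᶠ i) ≡ false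
<ᶠ-irrefl i with i <ᶠ i in eq
... | false = refl
... | true  = contradiction (<ᵇ⇒< _ _ (Equivalence.from T-≡ eq)) (<-irrefl (refl {x = i}))

sum-map-++ : (f : A → ℕ) (xs ys : List A) →
             sum (map f (xs ++ ys)) ≡ sum (map f xs) + sum (map f ys)
sum-map-++ f xs ys = trans (cong sum (map-++ f xs ys)) (sum-++ (map f xs) (map f ys))

sum-concatMap : (g : A → List ℕ) (xs : List A) →
                sum (concatMap g xs) ≡ sum (map (λ x → sum (g x)) xs)
sum-concatMap g []       = refl
sum-concatMap g (x ∷ xs) =
  trans (sum-++ (g x) (concatMap g xs)) (cong (sum (g x) +_) (sum-concatMap g xs))

sum-map-concatMap : {B : Set} (f : B → ℕ) (g : A → List B) (xs : List A) →
                    sum (map f (concatMap g xs)) ≡ sum (map (λ x → sum (map f (g x))) xs)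
sum-map-concatMap f g []       = refl
sum-map-concatMap f g (x ∷ xs) =
  trans (sum-map-++ f (g x) (concatMap g xs)) (cong (sum (map f (g x)) +_) (sum-map-concatMap f g xs))

sum-map-if : (f : A → ℕ) (b : Bool) (x : A) →
             sum (map f (if b then x ∷ [] else [])) ≡ ⟦ b ⟧ * f x
sum-map-if f true  x = refl
sum-map-if f false x = refl

sum-map-filter : (f : A → ℕ) (b : A → Bool) (xs : List A) →
                 sum (map f (filter (λ x → Data.Bool._≟_ (b x) true) xs))
                   ≡ sum (map (λ x → ⟦ b x ⟧ * f x) xs)
sum-map-filter f b []       = refl
sum-map-filter f b (x ∷ xs) with b x
... | true  = cong₂ _+_ (sym (+-identityʳ (f x))) (sum-map-filter f b xs)
... | false = sum-map-filter f b xs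

sum-tabulate : (f : Fin m → ℕ) → sum (tabulate f) ≡ ∑[ i < m ] f i
sum-tabulate {zero}  f = refl
sum-tabulate {suc m} f = cong (f fzero +_) (sum-tabulate (λ i → f (fsuc i)))

sum-map-allFin : (f : Fin m → ℕ) → sum (map f (allFin m)) ≡ ∑[ i < m ] f i
sum-map-allFin f = trans (cong sum (map-tabulate (λ i → i) f)) (sum-tabulate f)

countPairs-sum : (R : A → A → Bool) (xs : List A) →
                 countPairs R xs ≡ sum (map (λ x → sum (map (λ y → ⟦ R x y ⟧) xs)) xs)
countPairs-sum R xs = sum-concatMap (λ x → map (λ y → ⟦ R x y ⟧) xs) xs

extend : Fin m × Fin m → List (Ext m × Ext m)
extend (a , b) = (pt a , pt b) ∷ (-∞ , pt a) ∷ (pt b , +∞) ∷ []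

crossingsBetween : Fin m × Fin m → Fin m × Fin m → ℕ
crossingsBetween e f =
  sum (map (λ g → sum (map (λ h → ⟦ crossesᵉ g h ⟧) (extend f))) (extend e))

weight : Fin m × Fin m → Fin m × Fin m → ℕ
weight e f = 3 * ⟦ isCrossing e f ⟧ + 2 * ⟦ isNesting e f ⟧ + ⟦ isAlignment e f ⟧

symmetrized : (Fin m × Fin m → Fin m × Fin m → ℕ) → Fin m × Fin m → Fin m × Fin m → ℕ
symmetrized F e f = F e f + F f e

EndpointsDistinct : Fin m × Fin m → Fin m × Fin m → Set
EndpointsDistinct (a , b) (c , d) = a ≢ c × a ≢ d × b ≢ c × b ≢ d

-- Each clause rewrites exactly the comparisons occurring in its goal, the false ones first:
-- a true comparison can make _∧_ discard a later one.
module _ {a b c d : Fin m} where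

  crossingsBetween-aligned : a < b → b < c → c < d →
    symmetrized crossingsBetween (a , b) (c , d) ≡ symmetrized weight (a , b) (c , d)
  crossingsBetween-aligned a<b b<c c<d
    rewrite <⇒≯ᶠ b<c | <⇒≯ᶠ (<-trans a<b b<c) | <⇒≯ᶠ (<-trans b<c c<d)
          | <⇒≯ᶠ (<-trans a<b (<-trans b<c c<d))
          | <⇒<ᶠ a<b | <⇒<ᶠ b<c | <⇒<ᶠ c<d | <⇒<ᶠ (<-trans a<b b<c) | <⇒<ᶠ (<-trans b<c c<d)
          | <⇒<ᶠ (<-trans a<b (<-trans b<c c<d)) = refl

  crossingsBetween-crossing : a < c → c < b → b < d →
    symmetrized crossingsBetween (a , b) (c , d) ≡ symmetrized weight (a , b) (c , d)
  crossingsBetween-crossing a<c c<b b<d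
    rewrite <⇒≯ᶠ a<c | <⇒≯ᶠ c<b | <⇒≯ᶠ b<d | <⇒≯ᶠ (<-trans a<c (<-trans c<b b<d))
          | <⇒<ᶠ a<c | <⇒<ᶠ c<b | <⇒<ᶠ b<d | <⇒<ᶠ (<-trans a<c c<b) | <⇒<ᶠ (<-trans c<b b<d)
          | <⇒<ᶠ (<-trans a<c (<-trans c<b b<d)) = refl

  crossingsBetween-nesting : a < c → c < d → d < b →
    symmetrized crossingsBetween (a , b) (c , d) ≡ symmetrized weight (a , b) (c , d)
  crossingsBetween-nesting a<c c<d d<b
    rewrite <⇒≯ᶠ a<c | <⇒≯ᶠ d<b | <⇒≯ᶠ (<-trans a<c c<d) | <⇒≯ᶠ (<-trans c<d d<b)
          | <⇒<ᶠ a<c | <⇒<ᶠ c<d | <⇒<ᶠ d<b | <⇒<ᶠ (<-trans a<c c<d) | <⇒<ᶠ (<-trans c<d d<b)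
          | <⇒<ᶠ (<-trans a<c (<-trans c<d d<b)) = refl

  crossingsBetween-leftmost : a < b → c < d → a < c → b ≢ c → b ≢ d →
    symmetrized crossingsBetween (a , b) (c , d) ≡ symmetrized weight (a , b) (c , d)
  crossingsBetween-leftmost a<b c<d a<c b≢c b≢d with <-cmp b c
  ... | tri< b<c _ _   = crossingsBetween-aligned a<b b<c c<d
  ... | tri≈ _ b≡c _   = contradiction b≡c b≢c
  ... | tri> _ _ c<b with <-cmp b d
  ...   | tri< b<d _ _ = crossingsBetween-crossing a<c c<b b<d
  ...   | tri≈ _ b≡d _ = contradiction b≡d b≢d
  ...   | tri> _ _ d<b = crossingsBetween-nesting a<c c<d d<b

crossingsBetween-self : {a b : Fin m} → a < b →
  symmetrized crossingsBetween (a , b) (a , b) ≡ symmetrized weight (a , b) (a , b)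
crossingsBetween-self {a = a} {b} a<b
  rewrite <⇒<ᶠ a<b | <⇒≯ᶠ a<b | <ᶠ-irrefl a | <ᶠ-irrefl b = refl

crossingsBetween-symmetrized : {a b c d : Fin m} → a < b → c < d →
  (a , b) ≡ (c , d) ⊎ EndpointsDistinct (a , b) (c , d) →
  symmetrized crossingsBetween (a , b) (c , d) ≡ symmetrized weight (a , b) (c , d)
crossingsBetween-symmetrized a<b _ (inj₁ refl) = crossingsBetween-self a<b
crossingsBetween-symmetrized {a = a} {b} {c} {d} a<b c<d (inj₂ (a≢c , a≢d , b≢c , b≢d))
  with <-cmp a c
... | tri< a<c _ _ = crossingsBetween-leftmost a<b c<d a<c b≢c b≢d
... | tri≈ _ a≡c _ = contradiction a≡c a≢c
... | tri> _ _ c<a =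
  trans (+-comm (crossingsBetween (a , b) (c , d)) _)
    (trans (crossingsBetween-leftmost c<d a<b c<a (a≢d ∘ sym) (b≢d ∘ sym))
           (+-comm (weight (c , d) (a , b)) _))

module _ {n : ℕ} (π : PM n) where

  isOpener : Fin (2 * n) → Bool
  isOpener i = i <ᶠ partner π i

  arcAt : Fin (2 * n) → Fin (2 * n) × Fin (2 * n)
  arcAt i = (i , partner π i)

  arcSum : (Fin (2 * n) × Fin (2 * n) → ℕ) → ℕ
  arcSum f = ∑[ i < 2 * n ] (⟦ isOpener i ⟧ * f (arcAt i))

  arcPairSum : (Fin (2 * n) × Fin (2 * n) → Fin (2 * n) × Fin (2 * n) → ℕ) → ℕ
  arcPairSum F = arcSum (λ e → arcSum (F e))

  sum-arcs : (f : Fin (2 * n) × Fin (2 * n) → ℕ) → sum (map f (arcs π)) ≡ arcSum f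
  sum-arcs f = begin
    sum (map f (arcs π))
      ≡⟨ sum-map-concatMap f _ (allFin (2 * n)) ⟩
    sum (map (λ i → sum (map f (if isOpener i then arcAt i ∷ [] else []))) (allFin (2 * n)))
      ≡⟨ cong sum (map-cong (λ i → sum-map-if f (isOpener i) (arcAt i)) (allFin (2 * n))) ⟩
    sum (map (λ i → ⟦ isOpener i ⟧ * f (arcAt i)) (allFin (2 * n)))
      ≡⟨ sum-map-allFin (λ i → ⟦ isOpener i ⟧ * f (arcAt i)) ⟩
    arcSum f ∎
    where open ≡-Reasoning

  sum-openers : (f : Fin (2 * n) → ℕ) →
                sum (map f (openers π)) ≡ ∑[ i < 2 * n ] (⟦ isOpener i ⟧ * f i)
  sum-openers f =
    trans (sum-map-filter f isOpener (allFin (2 * n))) (sum-map-allFin (λ i → ⟦ isOpener i ⟧ * f i))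

  sum-closers : (f : Fin (2 * n) → ℕ) →
                sum (map f (closers π)) ≡ ∑[ i < 2 * n ] (⟦ isOpener i ⟧ * f (partner π i))
  sum-closers f = begin
    sum (map f (closers π))
      ≡⟨ trans (sum-map-filter f isCloser (allFin (2 * n))) (sum-map-allFin (λ i → ⟦ isCloser i ⟧ * f i)) ⟩
    ∑[ i < 2 * n ] (⟦ isCloser i ⟧ * f i)
      ≡⟨ ∑-permute _ partnerPermutation ⟩
    ∑[ i < 2 * n ] (⟦ isCloser (partner π i) ⟧ * f (partner π i))
      ≡⟨ sum-cong-≗ (λ i → cong (λ k → ⟦ k <ᶠ partner π i ⟧ * f (partner π i)) (involutive π i)) ⟩
    ∑[ i < 2 * n ] (⟦ isOpener i ⟧ * f (partner π i)) ∎
    where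
    open ≡-Reasoning
    isCloser : Fin (2 * n) → Bool
    isCloser i = partner π i <ᶠ i
    partnerPermutation : Permutation (2 * n) (2 * n)
    partnerPermutation = permutation (partner π) (partner π) (involutive π) (involutive π)

  arcSum-cong : (f g : Fin (2 * n) × Fin (2 * n) → ℕ) →
                (∀ i → T (isOpener i) → f (arcAt i) ≡ g (arcAt i)) → arcSum f ≡ arcSum g
  arcSum-cong f g f≡g = sum-cong-≗ (λ i → ⟦⟧*-cong (isOpener i) (f≡g i))

  arcSum-zero : arcSum (λ _ → 0) ≡ 0
  arcSum-zero = trans (sum-cong-≗ (λ i → *-zeroʳ ⟦ isOpener i ⟧)) (sum-replicate-zero (2 * n))

  arcSum-+ : (f g : Fin (2 * n) × Fin (2 * n) → ℕ) →
             arcSum (λ e → f e + g e) ≡ arcSum f + arcSum g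
  arcSum-+ f g = trans (sum-cong-≗ (λ i → *-distribˡ-+ ⟦ isOpener i ⟧ (f (arcAt i)) (g (arcAt i))))
                       (∑-distrib-+ (λ i → ⟦ isOpener i ⟧ * f (arcAt i)) (λ i → ⟦ isOpener i ⟧ * g (arcAt i)))

  arcSum-scale : (k : ℕ) (f : Fin (2 * n) × Fin (2 * n) → ℕ) →
                 k * arcSum f ≡ arcSum (λ e → k * f e)
  arcSum-scale k f = trans (*-distribˡ-sum k (λ i → ⟦ isOpener i ⟧ * f (arcAt i)))
    (sum-cong-≗ (λ i → x∙yz≈y∙xz *-commutativeSemigroup k ⟦ isOpener i ⟧ (f (arcAt i))))

  sum-map-arcSum : (F : A → Fin (2 * n) × Fin (2 * n) → ℕ) (xs : List A) →
                   sum (map (λ x → arcSum (F x)) xs) ≡ arcSum (λ e → sum (map (λ x → F x e) xs))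
  sum-map-arcSum F []       = sym arcSum-zero
  sum-map-arcSum F (x ∷ xs) =
    trans (cong (arcSum (F x) +_) (sum-map-arcSum F xs))
          (sym (arcSum-+ (F x) (λ e → sum (map (λ y → F y e) xs))))

  sum-extendedArcs : (f : Ext (2 * n) × Ext (2 * n) → ℕ) →
                     sum (map f (extendedArcs π)) ≡ arcSum (λ e → sum (map f (extend e)))
  sum-extendedArcs f = begin
    sum (map f (extendedArcs π))
      ≡⟨ trans (sum-map-++ f arcList (openerList ++ closerList))
               (cong (sum (map f arcList) +_) (sum-map-++ f openerList closerList)) ⟩
    sum (map f arcList) + (sum (map f openerList) + sum (map f closerList))
      ≡⟨ cong₂ _+_ (trans (cong sum (sym (map-∘ (arcs π)))) (sum-arcs inner))
                   (cong₂ _+_ (trans (cong sum (sym (map-∘ (openers π)))) (sum-openers (λ a → f (-∞ , pt a))))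
                              (trans (cong sum (sym (map-∘ (closers π)))) (sum-closers (λ b → f (pt b , +∞))))) ⟩
    arcSum inner + (arcSum lower + arcSum upper)
      ≡⟨ trans (cong (arcSum inner +_) (sym (arcSum-+ lower upper)))
               (sym (arcSum-+ inner (λ e → lower e + upper e))) ⟩
    arcSum (λ e → inner e + (lower e + upper e))
      ≡⟨ arcSum-cong (λ e → inner e + (lower e + upper e)) (λ e → sum (map f (extend e)))
           (λ i _ → cong (λ x → inner (arcAt i) + (lower (arcAt i) + x))
                         (sym (+-identityʳ (upper (arcAt i))))) ⟩
    arcSum (λ e → sum (map f (extend e))) ∎
    where
    open ≡-Reasoning
    arcList openerList closerList : List (Ext (2 * n) × Ext (2 * n))
    arcList    = map (λ (a , b) → (pt a , pt b)) (arcs π)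
    openerList = map (λ a → (-∞ , pt a)) (openers π)
    closerList = map (λ b → (pt b , +∞)) (closers π)
    inner lower upper : Fin (2 * n) × Fin (2 * n) → ℕ
    inner (a , b) = f (pt a , pt b)
    lower (a , _) = f (-∞ , pt a)
    upper (_ , b) = f (pt b , +∞)

  intertwining-arcPairSum : intertwining π ≡ arcPairSum crossingsBetween
  intertwining-arcPairSum = begin
    intertwining π
      ≡⟨ countPairs-sum crossesᵉ (extendedArcs π) ⟩
    sum (map (λ g → sum (map (crossings g) (extendedArcs π))) (extendedArcs π))
      ≡⟨ cong sum (map-cong (λ g → sum-extendedArcs (crossings g)) (extendedArcs π)) ⟩
    sum (map (λ g → arcSum (crossingsWith g)) (extendedArcs π))
      ≡⟨ sum-extendedArcs (λ g → arcSum (crossingsWith g)) ⟩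
    arcSum (λ e → sum (map (λ g → arcSum (crossingsWith g)) (extend e)))
      ≡⟨ arcSum-cong (λ e → sum (map (λ g → arcSum (crossingsWith g)) (extend e)))
                  (λ e → arcSum (crossingsBetween e))
                     (λ i _ → sum-map-arcSum crossingsWith (extend (arcAt i))) ⟩
    arcPairSum crossingsBetween ∎
    where
    open ≡-Reasoning
    crossings : Ext (2 * n) × Ext (2 * n) → Ext (2 * n) × Ext (2 * n) → ℕ
    crossings g h = ⟦ crossesᵉ g h ⟧
    crossingsWith : Ext (2 * n) × Ext (2 * n) → Fin (2 * n) × Fin (2 * n) → ℕ
    crossingsWith g f = sum (map (crossings g) (extend f))

  countPairs-arcs : (R : Fin (2 * n) × Fin (2 * n) → Fin (2 * n) × Fin (2 * n) → Bool) →
                    countPairs R (arcs π) ≡ arcPairSum (λ e f → ⟦ R e f ⟧)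
  countPairs-arcs R = begin
    countPairs R (arcs π)
      ≡⟨ countPairs-sum R (arcs π) ⟩
    sum (map (λ e → sum (map (λ f → ⟦ R e f ⟧) (arcs π))) (arcs π))
      ≡⟨ cong sum (map-cong (λ e → sum-arcs (λ f → ⟦ R e f ⟧)) (arcs π)) ⟩
    sum (map (λ e → arcSum (λ f → ⟦ R e f ⟧)) (arcs π))
      ≡⟨ sum-arcs (λ e → arcSum (λ f → ⟦ R e f ⟧)) ⟩
    arcPairSum (λ e f → ⟦ R e f ⟧) ∎
    where open ≡-Reasoning

  arcPairSum-+ : (F G : Fin (2 * n) × Fin (2 * n) → Fin (2 * n) × Fin (2 * n) → ℕ) →
                 arcPairSum (λ e f → F e f + G e f) ≡ arcPairSum F + arcPairSum G
  arcPairSum-+ F G =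
    trans (arcSum-cong (λ e → arcSum (λ f → F e f + G e f)) (λ e → arcSum (F e) + arcSum (G e))
                       (λ i _ → arcSum-+ (F (arcAt i)) (G (arcAt i))))
          (arcSum-+ (λ e → arcSum (F e)) (λ e → arcSum (G e)))

  arcPairSum-scale : (k : ℕ) (F : Fin (2 * n) × Fin (2 * n) → Fin (2 * n) × Fin (2 * n) → ℕ) →
                     k * arcPairSum F ≡ arcPairSum (λ e f → k * F e f)
  arcPairSum-scale k F =
    trans (arcSum-scale k (λ e → arcSum (F e)))
          (arcSum-cong (λ e → k * arcSum (F e)) (λ e → arcSum (λ f → k * F e f)) (λ i _ → arcSum-scale k (F (arcAt i))))

  weightedCount-arcPairSum : 3 * cr π + 2 * ne π + al π ≡ arcPairSum weight
  weightedCount-arcPairSum = begin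
    3 * cr π + 2 * ne π + al π
      ≡⟨ cong₂ _+_ (cong₂ _+_ (cong (3 *_) (countPairs-arcs isCrossing))
                              (cong (2 *_) (countPairs-arcs isNesting)))
                   (countPairs-arcs isAlignment) ⟩
    3 * arcPairSum cross + 2 * arcPairSum nest + arcPairSum align
      ≡⟨ cong (_+ arcPairSum align) (cong₂ _+_ (arcPairSum-scale 3 cross) (arcPairSum-scale 2 nest)) ⟩
    arcPairSum (λ e f → 3 * cross e f) + arcPairSum (λ e f → 2 * nest e f) + arcPairSum align
      ≡⟨ cong (_+ arcPairSum align) (sym (arcPairSum-+ (λ e f → 3 * cross e f) (λ e f → 2 * nest e f))) ⟩
    arcPairSum (λ e f → 3 * cross e f + 2 * nest e f) + arcPairSum align
      ≡⟨ sym (arcPairSum-+ (λ e f → 3 * cross e f + 2 * nest e f) align) ⟩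
    arcPairSum weight ∎
    where
    open ≡-Reasoning
    cross nest align : Fin (2 * n) × Fin (2 * n) → Fin (2 * n) × Fin (2 * n) → ℕ
    cross e f = ⟦ isCrossing e f ⟧
    nest e f = ⟦ isNesting e f ⟧
    align e f = ⟦ isAlignment e f ⟧

  arcPairSum-∑∑ : (F : Fin (2 * n) × Fin (2 * n) → Fin (2 * n) × Fin (2 * n) → ℕ) →
                  arcPairSum F ≡ ∑[ i < 2 * n ] ∑[ j < 2 * n ]
                                   (⟦ isOpener i ⟧ * (⟦ isOpener j ⟧ * F (arcAt i) (arcAt j)))
  arcPairSum-∑∑ F =
    sum-cong-≗ (λ i → *-distribˡ-sum ⟦ isOpener i ⟧ (λ j → ⟦ isOpener j ⟧ * F (arcAt i) (arcAt j)))

  arcPairSum-transpose : (F : Fin (2 * n) × Fin (2 * n) → Fin (2 * n) × Fin (2 * n) → ℕ) →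
                         arcPairSum F ≡ arcPairSum (flip F)
  arcPairSum-transpose F = begin
    arcPairSum F
      ≡⟨ arcPairSum-∑∑ F ⟩
    ∑[ i < 2 * n ] ∑[ j < 2 * n ] (⟦ isOpener i ⟧ * (⟦ isOpener j ⟧ * F (arcAt i) (arcAt j)))
      ≡⟨ ∑-comm (λ i j → ⟦ isOpener i ⟧ * (⟦ isOpener j ⟧ * F (arcAt i) (arcAt j))) ⟩
    ∑[ j < 2 * n ] ∑[ i < 2 * n ] (⟦ isOpener i ⟧ * (⟦ isOpener j ⟧ * F (arcAt i) (arcAt j)))
      ≡⟨ sum-cong-≗ (λ j → sum-cong-≗ (λ i →
           x∙yz≈y∙xz *-commutativeSemigroup ⟦ isOpener i ⟧ ⟦ isOpener j ⟧ (F (arcAt i) (arcAt j)))) ⟩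
    ∑[ j < 2 * n ] ∑[ i < 2 * n ] (⟦ isOpener j ⟧ * (⟦ isOpener i ⟧ * F (arcAt i) (arcAt j)))
      ≡⟨ arcPairSum-∑∑ (flip F) ⟨
    arcPairSum (flip F) ∎
    where open ≡-Reasoning

  arcPairSum-symmetrize :
    (F G : Fin (2 * n) × Fin (2 * n) → Fin (2 * n) × Fin (2 * n) → ℕ) →
    (∀ i j → T (isOpener i) → T (isOpener j) →
       symmetrized F (arcAt i) (arcAt j) ≡ symmetrized G (arcAt i) (arcAt j)) →
    arcPairSum F ≡ arcPairSum G
  arcPairSum-symmetrize F G F≈G = *-cancelˡ-≡ (arcPairSum F) (arcPairSum G) 2 (begin
    2 * arcPairSum F
      ≡⟨ cong (arcPairSum F +_) (+-identityʳ (arcPairSum F)) ⟩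
    arcPairSum F + arcPairSum F
      ≡⟨ cong (arcPairSum F +_) (arcPairSum-transpose F) ⟩
    arcPairSum F + arcPairSum (flip F)
      ≡⟨ arcPairSum-+ F (flip F) ⟨
    arcPairSum (symmetrized F)
      ≡⟨ arcSum-cong (λ e → arcSum (symmetrized F e)) (λ e → arcSum (symmetrized G e))
           (λ i oᵢ → arcSum-cong (symmetrized F (arcAt i)) (symmetrized G (arcAt i))
                       (λ j oⱼ → F≈G i j oᵢ oⱼ)) ⟩
    arcPairSum (symmetrized G)
      ≡⟨ arcPairSum-+ G (flip G) ⟩
    arcPairSum G + arcPairSum (flip G)
      ≡⟨ cong (arcPairSum G +_) (arcPairSum-transpose G) ⟨
    arcPairSum G + arcPairSum G
      ≡⟨ cong (arcPairSum G +_) (+-identityʳ (arcPairSum G)) ⟨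
    2 * arcPairSum G ∎)
    where open ≡-Reasoning

  opener⇒< : ∀ {i} → T (isOpener i) → i < partner π i
  opener⇒< = <ᵇ⇒< _ _

  partner-injective : ∀ {i j} → partner π i ≡ partner π j → i ≡ j
  partner-injective {i} {j} pᵢ≡pⱼ =
    trans (sym (involutive π i)) (trans (cong (partner π) pᵢ≡pⱼ) (involutive π j))

  openers-unpaired : ∀ {i j} → T (isOpener i) → T (isOpener j) → partner π i ≢ j
  openers-unpaired {i} {j} oᵢ oⱼ pᵢ≡j = <-asym (subst (i <_) pᵢ≡j (opener⇒< oᵢ))
                                               (subst (j <_) pⱼ≡i (opener⇒< oⱼ))
    where
    pⱼ≡i : partner π j ≡ i
    pⱼ≡i = trans (cong (partner π) (sym pᵢ≡j)) (involutive π i)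

  arcs-equal-or-disjoint : ∀ {i j} → T (isOpener i) → T (isOpener j) →
                           arcAt i ≡ arcAt j ⊎ EndpointsDistinct (arcAt i) (arcAt j)
  arcs-equal-or-disjoint {i} {j} oᵢ oⱼ with i ≟ j
  ... | yes refl = inj₁ refl
  ... | no i≢j   = inj₂ ( i≢j
                        , (openers-unpaired oⱼ oᵢ ∘ sym)
                        , openers-unpaired oᵢ oⱼ
                        , (i≢j ∘ partner-injective) )

mainTheorem3 : (n : ℕ) (π : PM n) →
    intertwining π ≡ 3 * cr π + 2 * ne π + al π
mainTheorem3 n π = begin
  intertwining π
    ≡⟨ intertwining-arcPairSum π ⟩
  arcPairSum π crossingsBetween
    ≡⟨ arcPairSum-symmetrize π crossingsBetween weight (λ i j oᵢ oⱼ →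
         crossingsBetween-symmetrized (opener⇒< π oᵢ) (opener⇒< π oⱼ)
                                      (arcs-equal-or-disjoint π oᵢ oⱼ)) ⟩
  arcPairSum π weight
    ≡⟨ weightedCount-arcPairSum π ⟨
  3 * cr π + 2 * ne π + al π ∎
  where open ≡-Reasoning
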